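{- For every slice alignment graph $G=\mathsf{SAG}^{n,m}(\pi,\pi',S)$, the matrix $D_G$ is a Monge matrix and the matrix $M_G$ is a simple unit-Monge matrix.
   Context: Integer intervals $[a..b]$. Grid $\mathcal{G}^{n,m}=[0..n]\times[0..m]$. For $S\subseteq\mathcal{G}^{n-1,m-1}$, $\mathsf{AG}^{n,m}(S)$ is the undirected weighted graph on $\mathcal{G}^{n,m}$ with weight-$1$ edges $(x,y)$--$(x+1,y)$ and $(x,y)$--$(x,y+1)$ (whenever both endpoints lie in the grid) and weight-$0$ edges $(x,y)$--$(x+1,y+1)$ for $(x,y)\in S$. $(x,y)\prec(x',y')$ iff $x<x'$ and $y<y'$; $p\preceq q$ iff $p=q$ or $p\prec q$. Diagonals $\mathcal{D}^{n,m}_d=\{(x,y): x-y=d-m\}$, $d\in[0..n+m]$. A cut-path is a sequence $\pi=(\pi_d)_{d=0}^{n+m}$ with $\pi_d\in\mathcal{D}^{n,m}_d$ no two of whose elements are $\prec$-comparable; $\pi\preceq\pi'$ iff $\pi_d\preceq\pi'_d$ for all $d$. For cut-paths $\pi\preceq\pi'$, $\mathsf{SAG}^{n,m}(\pi,\pi',S)$ is the subgraph of $\mathsf{AG}^{n,m}(S)$ induced by $\{(x,y)\in\mathcal{G}^{n,m}:\pi_{x-y+m}\preceq(x,y)\preceq\pi'_{x-y+m}\}$. For such $G$, define $D_G,M_G\in\mathbb{R}^{(n+m+1)\times(n+m+1)}$ (rows and columns indexed by $[0..n+m]$) by $D_G[a,b]=\mathrm{dist}_G(\pi_a,\pi'_b)$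 and $M_G[a,b]=\frac12(D_G[a,b]-a+b)$. For a matrix $A$ with rows $[0..r]$ and columns $[0..c]$, its density matrix $A^\square$ (rows $[0..r)$, columns $[0..c)$) is $A^\square[i,j]=A[i+1,j]+A[i,j+1]-A[i,j]-A[i+1,j+1]$. $A$ is Monge if $A^\square$ has non-negative entries, unit-Monge if $A^\square$ is a permutation matrix (each row and column has exactly one entry $1$, others $0$), and simple if $A[r,j]=0$ for all $j$ and $A[i,0]=0$ for all $i$. -}

module Defs where

open import Data.Nat as ℕ using (ℕ; zero; suc; _<_; _≤_)
open import Data.Integer using (+_)
open import Data.Rational using (ℚ; _/_; 0ℚ; 1ℚ; ½)
import Data.Rational as Q
open import Data.Bool using (Bool; true)
open import Data.Product using (_×_; _,_; Σ; proj₁; proj₂)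
open import Data.Sum using (_⊎_)
open import Relation.Binary.PropositionalEquality using (_≡_; _≢_)
open import Relation.Nullary using (¬_)

Point : Set
Point = ℕ × ℕ

InGrid : ℕ → ℕ → Point → Set
InGrid n m (x , y) = x ≤ n × y ≤ m

_≺_ : Point → Point → Set
(x , y) ≺ (x' , y') = x < x' × y < y'

_⪯_ : Point → Point → Set
p ⪯ q = p ≡ q ⊎ p ≺ q

-- (x , y) ∈ 𝒟^{n,m}_d  iff  x - y = d - m  (written without subtraction: x + m = d + y)
OnDiag : ℕ → ℕ → Point → Set
OnDiag m d (x , y) = x ℕ.+ m ≡ d ℕ.+ y

-- diagonal index x - y + m of a point (meaningful for y ≤ m)
diagIdx : ℕ → Point → ℕ
diagIdx m (x , y) = (x ℕ.+ m) ℕ.∸ y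

-- A cut-path (π_d)_{d=0}^{n+m}, represented as a function ℕ → Point whose
-- values for d ∈ [0..n+m] matter.
record IsCutPath (n m : ℕ) (π : ℕ → Point) : Set where
  field
    inGrid  : ∀ d → d ≤ n ℕ.+ m → InGrid n m (π d)
    onDiag  : ∀ d → d ≤ n ℕ.+ m → OnDiag m d (π d)
    antichain : ∀ d d' → d ≤ n ℕ.+ m → d' ≤ n ℕ.+ m → ¬ (π d ≺ π d')

CutLeq : ℕ → ℕ → (ℕ → Point) → (ℕ → Point) → Set
CutLeq n m π π' = ∀ d → d ≤ n ℕ.+ m → π d ⪯ π' d

InSAG : ℕ → ℕ → (ℕ → Point) → (ℕ → Point) → Point → Set
InSAG n m π π' p = InGrid n m p × (π (diagIdx m p) ⪯ p) × (p ⪯ π' (diagIdx m p))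

-- Edges of AG^{n,m}(S) (undirected), with weight.  S ⊆ 𝒢^{n-1,m-1} is given
-- as a Boolean indicator function.
data AGEdge (S : ℕ → ℕ → Bool) : Point → Point → ℕ → Set where
  horiz  : ∀ x y → AGEdge S (x , y) (suc x , y) 1
  horiz⁻ : ∀ x y → AGEdge S (suc x , y) (x , y) 1
  vert   : ∀ x y → AGEdge S (x , y) (x , suc y) 1
  vert⁻  : ∀ x y → AGEdge S (x , suc y) (x , y) 1
  diag   : ∀ x y → S x y ≡ true → AGEdge S (x , y) (suc x , suc y) 0
  diag⁻  : ∀ x y → S x y ≡ true → AGEdge S (suc x , suc y) (x , y) 0

-- Walks in the induced subgraph SAG^{n,m}(π, π', S) from p to q of total weight w
-- (both endpoints of every edge lie in the vertex set, which lies in the grid).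
data Walk (n m : ℕ) (π π' : ℕ → Point) (S : ℕ → ℕ → Bool) : Point → Point → ℕ → Set where
  here : ∀ {p} → InSAG n m π π' p → Walk n m π π' S p p 0
  step : ∀ {p q r e w} → InSAG n m π π' p → AGEdge S p q e →
         Walk n m π π' S q r w → Walk n m π π' S p r (e ℕ.+ w)

IsDist : ℕ → ℕ → (ℕ → Point) → (ℕ → Point) → (ℕ → ℕ → Bool) → Point → Point → ℕ → Set
IsDist n m π π' S p q d =
  Walk n m π π' S p q d × (∀ w → Walk n m π π' S p q w → d ≤ w)

-- Matrices with rows [0..r] and columns [0..c], as functions ℕ → ℕ → ℚ
-- (only entries with i ≤ r, j ≤ c are relevant).
Matrix : Set
Matrix = ℕ → ℕ → ℚ

density : Matrix → Matrix
density A i j = ((A (suc i) j Q.+ A i (suc j)) Q.- A i j) Q.- A (suc i) (suc j)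

IsMonge : ℕ → ℕ → Matrix → Set
IsMonge r c A = ∀ i j → i < r → j < c → 0ℚ Q.≤ density A i j

IsPermutationMatrix : ℕ → ℕ → Matrix → Set
IsPermutationMatrix r c P =
  (∀ i j → i < r → j < c → P i j ≡ 0ℚ ⊎ P i j ≡ 1ℚ) ×
  (∀ i → i < r → Σ ℕ λ j → j < c × P i j ≡ 1ℚ × (∀ j' → j' < c → j' ≢ j → P i j' ≡ 0ℚ)) ×
  (∀ j → j < c → Σ ℕ λ i → i < r × P i j ≡ 1ℚ × (∀ i' → i' < r → i' ≢ i → P i' j ≡ 0ℚ))

IsUnitMonge : ℕ → ℕ → Matrix → Set
IsUnitMonge r c A = IsPermutationMatrix r c (density A)

IsSimple : ℕ → ℕ → Matrix → Set
IsSimple r c A = (∀ j → j ≤ c → A r j ≡ 0ℚ) × (∀ i → i ≤ r → A i 0 ≡ 0ℚ)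

ℕtoℚ : ℕ → ℚ
ℕtoℚ k = + k / 1

Dmat : (ℕ → ℕ → ℕ) → Matrix
Dmat D a b = ℕtoℚ (D a b)

Mmat : (ℕ → ℕ → ℕ) → Matrix
Mmat D a b = ½ Q.* ((ℕtoℚ (D a b) Q.- ℕtoℚ a) Q.+ ℕtoℚ b)

module Submission where

-- Cut-paths are staircases from (0 , m) to (n , 0) moving by unit steps right or down.
-- D is Monge by induction on the area between π and π': if the paths coincide then
-- D a b = |a − b|; otherwise π' has an outer corner strictly above π, and cutting it off
-- changes a single column of D, into the column itself (when the corner's diagonal edge
-- exists) or into one plus the minimum of its two neighbouring columns, both of which keep
-- the Monge inequalities.  Every edge moves the diagonal index by at most its weight and by
-- its weight modulo 2, so adjacent entries of D differ by exactly one and the borders of D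
-- are those of |a − b|.  Then D (1+i) j − D i j runs through ±1 and, by Monge, switches
-- from +1 to −1 exactly once in each row (and likewise in each column), so D^□ is twice a
-- permutation matrix, while M^□ = D^□ / 2.

open import Defs
open import Data.Nat using (ℕ; zero; suc; _<_; _≤_; _+_; _∸_; _⊓_; z≤n; s≤s; z<s; _≟_; _<?_; ∣_-_∣)
open import Data.Nat.Properties
open import Data.Nat.Divisibility using (_∣_; divides; ∣-refl; ∣m∣n⇒∣m+n; ∣m+n∣m⇒∣n; ∣1⇒≡1)
import Data.Nat.Solver
open Data.Nat.Solver.+-*-Solver using (solve; _:+_; _:=_)
import Data.Integer as ℤ
import Data.Integer.Properties as ℤ
open import Data.Rational as ℚ using (0ℚ; 1ℚ; ½)
open import Data.Rational.Properties using (toℚᵘ-injective; toℚᵘ-fromℚᵘ; toℚᵘ-homo-+)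
import Data.Rational.Unnormalised as ℚᵘ
import Data.Rational.Unnormalised.Properties as ℚᵘ
import Data.Rational.Solver
open Data.Rational.Solver.+-*-Solver using () renaming (solve to solveℚ; _:+_ to _:+ℚ_; _:*_ to _:*ℚ_; _:-_ to _:-ℚ_; _:=_ to _:=ℚ_; con to conℚ)
open import Data.Bool using (Bool; true; false)
open import Data.Product using (_×_; Σ; _,_; proj₁; proj₂)
open import Data.Product.Properties using (≡-dec)
open import Data.Sum as Sum using (_⊎_; inj₁; inj₂; [_,_]′)
open import Data.Empty using (⊥; ⊥-elim)
open import Function using (_∘_)
open import Relation.Nullary using (¬_; Dec; yes; no)
open import Relation.Nullary.Decidable using (_×-dec_)
open import Relation.Binary.Definitions using (Tri; tri<; tri≈; tri>)
open import Relation.Binary.PropositionalEquality using (_≡_; _≢_; refl; sym; trans; cong; cong₂; subst; subst₂; module ≡-Reasoning)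

_≟ₚ_ : (p q : Point) → Dec (p ≡ q)
_≟ₚ_ = ≡-dec _≟_ _≟_

_≺?_ : (p q : Point) → Dec (p ≺ q)
(x , y) ≺? (x' , y') = (x <? x') ×-dec (y <? y')

≺-irrefl : ∀ {p} → ¬ (p ≺ p)
≺-irrefl (x<x , _) = <-irrefl refl x<x

⪯⇒≤₁ : ∀ {p q} → p ⪯ q → proj₁ p ≤ proj₁ q
⪯⇒≤₁ (inj₁ refl) = ≤-refl
⪯⇒≤₁ (inj₂ (x<x' , _)) = <⇒≤ x<x'

⪯⇒≺-suc : ∀ {p x y} → p ⪯ (x , y) → p ≺ (suc x , suc y)
⪯⇒≺-suc (inj₁ refl) = n<1+n _ , n<1+n _
⪯⇒≺-suc (inj₂ (x< , y<)) = m<n⇒m<1+n x< , m<n⇒m<1+n y<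

onDiag-cross : ∀ {m d a b x y} → OnDiag m d (a , b) → OnDiag m d (x , y) → a + y ≡ x + b
onDiag-cross {m} {d} {a} {b} {x} {y} onAB onXY = +-cancelʳ-≡ m (a + y) (x + b) (begin
  a + y + m   ≡⟨ solve 3 (λ a y m → (a :+ y) :+ m := (a :+ m) :+ y) refl a y m ⟩
  a + m + y   ≡⟨ cong (_+ y) onAB ⟩
  d + b + y   ≡⟨ solve 3 (λ d b y → (d :+ b) :+ y := (d :+ y) :+ b) refl d b y ⟩
  d + y + b   ≡⟨ cong (_+ b) (sym onXY) ⟩
  x + m + b   ≡⟨ solve 3 (λ x m b → (x :+ m) :+ b := (x :+ b) :+ m) refl x m b ⟩
  x + b + m   ∎)
  where open ≡-Reasoning

≺-suc⇒⪯ : ∀ {m d a b x y} → (a , b) ≺ (suc x , suc y) → OnDiag m d (a , b) → OnDiag m d (suc x , suc y) →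
          (a , b) ⪯ (x , y)
≺-suc⇒⪯ {m} {d} {a} {b} {x} {y} (s≤s a≤x , s≤s b≤y) onAB onXY = decide (a ≟ x) (b <? y)
  where
    a+y≡x+b : a + y ≡ x + b
    a+y≡x+b = suc-injective (trans (sym (+-suc a y)) (onDiag-cross {m} {d} onAB onXY))
    decide : Dec (a ≡ x) → Dec (b < y) → (a , b) ⪯ (x , y)
    decide (yes refl) _       = inj₁ (cong (a ,_) (sym (+-cancelˡ-≡ a y b a+y≡x+b)))
    decide (no a≢x) (yes b<y) = inj₂ (≤∧≢⇒< a≤x a≢x , b<y)
    decide (no a≢x) (no b≮y)  = ⊥-elim (<-irrefl a+y≡x+b (+-mono-<-≤ (≤∧≢⇒< a≤x a≢x) (≮⇒≥ b≮y)))

AGEdge-sym : ∀ {S p q e} → AGEdge S p q e → AGEdge S q p e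
AGEdge-sym (horiz x y)    = horiz⁻ x y
AGEdge-sym (horiz⁻ x y)   = horiz x y
AGEdge-sym (vert x y)     = vert⁻ x y
AGEdge-sym (vert⁻ x y)    = vert x y
AGEdge-sym (diag x y s)   = diag⁻ x y s
AGEdge-sym (diag⁻ x y s)  = diag x y s

Step : Point → Point → Set
Step p q = q ≡ (suc (proj₁ p) , proj₂ p) ⊎ p ≡ (proj₁ q , suc (proj₂ q))

Step⇒AGEdge : ∀ {S p q} → Step p q → AGEdge S p q 1
Step⇒AGEdge {p = p} (inj₁ refl) = horiz (proj₁ p) (proj₂ p)
Step⇒AGEdge {q = q} (inj₂ refl) = vert⁻ (proj₁ q) (proj₂ q)

incomparable⇒Step : ∀ {m d} p q → OnDiag m d p → OnDiag m (suc d) q → ¬ (p ≺ q) → ¬ (q ≺ p) → Step p q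
incomparable⇒Step {m} {d} (x , y) (x' , y') onP onQ p⊀q q⊀p = decide (<-cmp x x')
  where
    key : x' + y ≡ suc (x + y')
    key = trans (sym (onDiag-cross {m} {d} onP (trans onQ (sym (+-suc d y'))))) (+-suc x y')
    decide : Tri (x < x') (x ≡ x') (x' < x) → Step (x , y) (x' , y')
    decide (tri< x<x' _ _) = inj₁ (cong₂ _,_ x'≡1+x (sym y≡y'))
      where
        y'≤y : y' ≤ y
        y'≤y = ≮⇒≥ (λ y<y' → p⊀q (x<x' , y<y'))
        x'≡1+x : x' ≡ suc x
        x'≡1+x = ≤-antisym (+-cancelʳ-≤ y x' (suc x) (≤-trans (≤-reflexive key) (s≤s (+-monoʳ-≤ x y'≤y)))) x<x'
        y≡y' : y ≡ y'
        y≡y' = +-cancelˡ-≡ x y y' (suc-injective (trans (cong (_+ y) (sym x'≡1+x)) key))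
    decide (tri≈ _ refl _) = inj₂ (cong (x ,_) (+-cancelˡ-≡ x y (suc y') (trans key (sym (+-suc x y')))))
    decide (tri> _ _ x'<x) = ⊥-elim (q⊀p (x'<x , ≰⇒> λ y≤y' → <-irrefl key (s≤s (+-mono-≤ (<⇒≤ x'<x) y≤y'))))

diagIdx-onDiag : ∀ {m d} p → OnDiag m d p → diagIdx m p ≡ d
diagIdx-onDiag {m} {d} (x , y) onP = trans (cong (_∸ y) onP) (m+n∸n≡m d y)

onDiag-diagIdx : ∀ {m d} p → proj₂ p ≤ m → diagIdx m p ≡ d → OnDiag m d p
onDiag-diagIdx {m} (x , y) y≤m idx≡d = trans (sym (m∸n+n≡m (≤-trans y≤m (m≤n+m m x)))) (cong (_+ y) idx≡d)

data DiagShift (a b : ℕ) : ℕ → Set where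
  incr : b ≡ suc a → DiagShift a b 1
  decr : a ≡ suc b → DiagShift a b 1
  same : a ≡ b → DiagShift a b 0

AGEdge-diagShift : ∀ {m S p q e} → proj₂ p ≤ m → proj₂ q ≤ m → AGEdge S p q e →
                   DiagShift (diagIdx m p) (diagIdx m q) e
AGEdge-diagShift {m} p≤ q≤ (horiz x y)   = incr (+-∸-assoc 1 (≤-trans p≤ (m≤n+m m x)))
AGEdge-diagShift {m} p≤ q≤ (horiz⁻ x y)  = decr (+-∸-assoc 1 (≤-trans p≤ (m≤n+m m x)))
AGEdge-diagShift {m} p≤ q≤ (vert x y)    = decr (+-∸-assoc 1 (≤-trans q≤ (m≤n+m m x)))
AGEdge-diagShift {m} p≤ q≤ (vert⁻ x y)   = incr (+-∸-assoc 1 (≤-trans p≤ (m≤n+m m x)))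
AGEdge-diagShift p≤ q≤ (diag x y _)      = same refl
AGEdge-diagShift p≤ q≤ (diag⁻ x y _)     = same refl

diagShift-bounds : ∀ {a b e c w} → DiagShift a b e → c ≤ b + w × b ≤ c + w → c ≤ a + (e + w) × a ≤ c + (e + w)
diagShift-bounds {a} {c = c} {w} (incr refl) (c≤ , b≤) =
  subst (c ≤_) (sym (+-suc a w)) c≤ , ≤-trans (n≤1+n a) (≤-trans b≤ (+-monoʳ-≤ _ (n≤1+n w)))
diagShift-bounds {b = b} {c = c} {w = w} (decr refl) (c≤ , b≤) =
  ≤-trans c≤ (+-mono-≤ (n≤1+n b) (n≤1+n w)) , subst (suc b ≤_) (sym (+-suc c w)) (s≤s b≤)
diagShift-bounds (same refl) bounds = bounds

diagShift-parity : ∀ {a b e c w} → DiagShift a b e → 2 ∣ w + b + c → 2 ∣ (e + w) + a + c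
diagShift-parity {a} {c = c} {w = w} (incr refl) even = subst (2 ∣_) (cong (_+ c) (+-suc w a)) even
diagShift-parity {b = b} {c = c} {w = w} (decr refl) even =
  subst (2 ∣_) (cong (λ t → suc (t + c)) (sym (+-suc w b))) (∣m∣n⇒∣m+n ∣-refl even)
diagShift-parity (same refl) even = even

-- Walks

Walk-mono : ∀ {n m S π σ σ'} → (∀ p → InSAG n m π σ p → InSAG n m π σ' p) →
            ∀ {p q w} → Walk n m π σ S p q w → Walk n m π σ' S p q w
Walk-mono ⊆ (here p∈) = here (⊆ _ p∈)
Walk-mono ⊆ (step p∈ edge walk) = step (⊆ _ p∈) edge (Walk-mono ⊆ walk)

module Walks (n m : ℕ) (S : ℕ → ℕ → Bool) (π σ : ℕ → Point) where
  Region : Point → Set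
  Region = InSAG n m π σ

  Wk : Point → Point → ℕ → Set
  Wk = Walk n m π σ S

  source : ∀ {p q w} → Wk p q w → Region p
  source (here p∈) = p∈
  source (step p∈ _ _) = p∈

  target : ∀ {p q w} → Wk p q w → Region q
  target (here q∈) = q∈
  target (step _ _ walk) = target walk

  castʷ : ∀ {p q w w'} → w ≡ w' → Wk p q w → Wk p q w'
  castʷ refl walk = walk

  castᵗ : ∀ {p q q' w} → q ≡ q' → Wk p q w → Wk p q' w
  castᵗ refl walk = walk

  castˢ : ∀ {p p' q w} → p ≡ p' → Wk p q w → Wk p' q w
  castˢ refl walk = walk

  _++_ : ∀ {p q r w₁ w₂} → Wk p q w₁ → Wk q r w₂ → Wk p r (w₁ + w₂)
  here _ ++ walk' = walk'
  step {e = e} {w = w} p∈ edge walk ++ walk' = castʷ (sym (+-assoc e w _)) (step p∈ edge (walk ++ walk'))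

  _▷_∶_ : ∀ {p q r w e} → Wk p q w → AGEdge S q r e → Region r → Wk p r (w + e)
  _▷_∶_ {w = w} {e} walk edge r∈ = castʷ (cong (w +_) (+-identityʳ e)) (walk ++ step (target walk) edge (here r∈))

  reverse : ∀ {p q w} → Wk p q w → Wk q p w
  reverse (here p∈) = here p∈
  reverse (step {e = e} {w = w} p∈ edge walk) = castʷ (+-comm w e) (reverse walk ▷ AGEdge-sym edge ∶ p∈)

  diagIdx-bounds : ∀ {p q w} → Wk p q w → diagIdx m q ≤ diagIdx m p + w × diagIdx m p ≤ diagIdx m q + w
  diagIdx-bounds (here _) = m≤m+n _ 0 , m≤m+n _ 0
  diagIdx-bounds (step p∈ edge walk) =
    diagShift-bounds (AGEdge-diagShift (proj₂ (proj₁ p∈)) (proj₂ (proj₁ (source walk))) edge) (diagIdx-bounds walk)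

  -- Each edge moves the diagonal index by its weight modulo 2.
  diagIdx-parity : ∀ {p q w} → Wk p q w → 2 ∣ w + diagIdx m p + diagIdx m q
  diagIdx-parity (here {p} _) = divides k (trans (cong (k +_) (sym (+-identityʳ k))) (*-comm 2 k))
    where
      k : ℕ
      k = diagIdx m p
  diagIdx-parity (step p∈ edge walk) =
    diagShift-parity (AGEdge-diagShift (proj₂ (proj₁ p∈)) (proj₂ (proj₁ (source walk))) edge) (diagIdx-parity walk)

-- Staircases

record Staircase (n m : ℕ) (σ : ℕ → Point) : Set where
  field
    inGrid : ∀ d → d ≤ n + m → InGrid n m (σ d)
    onDiag : ∀ d → d ≤ n + m → OnDiag m d (σ d)
    next   : ∀ d → d < n + m → Step (σ d) (σ (suc d))
open Staircase

cutPath⇒staircase : ∀ {n m π} → IsCutPath n m π → Staircase n m π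
cutPath⇒staircase {π = π} cp = record
  { inGrid = IsCutPath.inGrid cp
  ; onDiag = onDiagπ
  ; next   = λ d d< → incomparable⇒Step (π d) (π (suc d)) (onDiagπ d (<⇒≤ d<)) (onDiagπ (suc d) d<)
                        (antichain d (suc d) (<⇒≤ d<) d<) (antichain (suc d) d d< (<⇒≤ d<))
  }
  where
    open IsCutPath cp using (antichain) renaming (onDiag to onDiagπ)

staircase-start : ∀ {n m σ} → Staircase n m σ → σ 0 ≡ (0 , m)
staircase-start {n} {m} {σ} st with σ 0 | inGrid st 0 z≤n | onDiag st 0 z≤n
... | (x , y) | (_ , y≤m) | x+m≡y with n≤0⇒n≡0 (+-cancelʳ-≤ m x 0 (≤-trans (≤-reflexive x+m≡y) y≤m))
... | refl = cong (0 ,_) (sym x+m≡y)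

staircase-end : ∀ {n m σ} → Staircase n m σ → σ (n + m) ≡ (n , 0)
staircase-end {n} {m} {σ} st with σ (n + m) | inGrid st (n + m) ≤-refl | onDiag st (n + m) ≤-refl
... | (x , y) | (x≤n , _) | x+m≡N+y
  with n≤0⇒n≡0 (+-cancelˡ-≤ (n + m) y 0 (≤-trans (≤-reflexive (sym x+m≡N+y))
                                          (≤-trans (+-monoˡ-≤ m x≤n) (≤-reflexive (sym (+-identityʳ (n + m)))))))
... | refl = cong (_, 0) (+-cancelʳ-≡ m x n (trans x+m≡N+y (+-identityʳ (n + m))))

≺-next-after-right : ∀ {p p' q q'} → p ≺ q → Step p p' → q' ≡ (suc (proj₁ q) , proj₂ q) → p' ≺ q'
≺-next-after-right (x< , y<) (inj₁ refl) refl = s≤s x< , y<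
≺-next-after-right (x< , y<) (inj₂ refl) refl = m<n⇒m<1+n x< , ≤-trans (n≤1+n _) y<

≺-prev-before-down : ∀ {p₀ p q q₀} → p ≺ q → Step p₀ p → q₀ ≡ (proj₁ q , suc (proj₂ q)) → p₀ ≺ q₀
≺-prev-before-down (x< , y<) (inj₁ refl) refl = ≤-trans (n≤1+n _) x< , m<n⇒m<1+n y<
≺-prev-before-down (x< , y<) (inj₂ refl) refl = x< , s≤s y<

-- (a , a') ⊑ (b , b') says a − a' ≤ b − b', stated without subtraction.
_⊑_ : ℕ × ℕ → ℕ × ℕ → Set
(a , a') ⊑ (b , b') = a + b' ≤ a' + b

⊑-trans : ∀ {p q r} → p ⊑ q → q ⊑ r → p ⊑ r
⊑-trans {e , e'} {g , g'} {f , f'} e⊑g g⊑f = +-cancelʳ-≤ (g + g') (e + f') (e' + f)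
  (subst₂ _≤_ (solve 4 (λ e g' g f' → (e :+ g') :+ (g :+ f') := (e :+ f') :+ (g :+ g')) refl e g' g f')
              (solve 4 (λ e' g g' f → (e' :+ g) :+ (g' :+ f) := (e' :+ f) :+ (g :+ g')) refl e' g g' f)
              (+-mono-≤ e⊑g g⊑f))

⊑-suc⊓ : ∀ {e e' f f'} → (e , e') ⊑ (f , f') → (e , e') ⊑ (suc (e ⊓ f) , suc (e' ⊓ f'))
⊑-suc⊓ {e} {e'} {f} {f'} e⊑f = subst₂ _≤_ (sym (+-suc e _)) (sym (+-suc e' _)) (s≤s (bound (⊓-sel e f)))
  where
    bound : e ⊓ f ≡ e ⊎ e ⊓ f ≡ f → e + (e' ⊓ f') ≤ e' + (e ⊓ f)
    bound (inj₁ ⊓≡e) = ≤-trans (+-monoʳ-≤ e (m⊓n≤m e' f')) (≤-reflexive (trans (+-comm e e') (cong (e' +_) (sym ⊓≡e))))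
    bound (inj₂ ⊓≡f) = ≤-trans (+-monoʳ-≤ e (m⊓n≤n e' f')) (≤-trans e⊑f (≤-reflexive (cong (e' +_) (sym ⊓≡f))))

suc⊓-⊑ : ∀ {e e' f f'} → (e , e') ⊑ (f , f') → (suc (e ⊓ f) , suc (e' ⊓ f')) ⊑ (f , f')
suc⊓-⊑ {e} {e'} {f} {f'} e⊑f = s≤s (bound (⊓-sel e' f'))
  where
    bound : e' ⊓ f' ≡ e' ⊎ e' ⊓ f' ≡ f' → (e ⊓ f) + f' ≤ (e' ⊓ f') + f
    bound (inj₁ ⊓≡e') = ≤-trans (+-monoˡ-≤ f' (m⊓n≤m e f)) (≤-trans e⊑f (≤-reflexive (cong (_+ f) (sym ⊓≡e'))))
    bound (inj₂ ⊓≡f') = ≤-trans (+-monoˡ-≤ f' (m⊓n≤n e f)) (≤-reflexive (trans (+-comm f f') (cong (_+ f) (sym ⊓≡f'))))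

∣m-n∣≤ : ∀ m n w → n ≤ m + w → m ≤ n + w → ∣ m - n ∣ ≤ w
∣m-n∣≤ zero n w n≤ m≤ = n≤
∣m-n∣≤ (suc m) zero w n≤ m≤ = m≤
∣m-n∣≤ (suc m) (suc n) w (s≤s n≤) (s≤s m≤) = ∣m-n∣≤ m n w n≤ m≤

∣-∣-monge : ∀ i j → ∣ i - j ∣ + ∣ suc i - suc j ∣ ≤ ∣ suc i - j ∣ + ∣ i - suc j ∣
∣-∣-monge zero zero = z≤n
∣-∣-monge zero (suc j) = ≤-reflexive (sym (+-suc j (suc j)))
∣-∣-monge (suc i) zero = ≤-reflexive (cong suc (trans (+-suc i i) (cong suc (cong (i +_) (sym (∣-∣-identityʳ i))))))
∣-∣-monge (suc i) (suc j) = ∣-∣-monge i j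

one-apart : ∀ A B k → A ≤ suc B → B ≤ suc A → 2 ∣ A + suc k → 2 ∣ B + k → A ≡ suc B ⊎ B ≡ suc A
one-apart A B k A≤ B≤ evenA evenB with <-cmp A B
... | tri< A<B _ _  = inj₂ (≤-antisym B≤ A<B)
... | tri> _ _ B<A  = inj₁ (≤-antisym A≤ B<A)
... | tri≈ _ refl _ = ⊥-elim (2≢1 (∣1⇒≡1 (∣m+n∣m⇒∣n (subst (2 ∣_) (trans (+-suc A k) (+-comm 1 (A + k))) evenA) evenB)))
  where
    2≢1 : 2 ≢ 1
    2≢1 ()

sumBelow : (ℕ → ℕ) → ℕ → ℕ
sumBelow f zero = 0
sumBelow f (suc k) = f k + sumBelow f k

sumBelow-cong : ∀ f g k → (∀ e → e < k → f e ≡ g e) → sumBelow f k ≡ sumBelow g k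
sumBelow-cong f g zero f≡g = refl
sumBelow-cong f g (suc k) f≡g = cong₂ _+_ (f≡g k (n<1+n k)) (sumBelow-cong f g k (λ e e< → f≡g e (m<n⇒m<1+n e<)))

sumBelow-suc-at : ∀ f g k d → d < k → f d ≡ suc (g d) → (∀ e → e ≢ d → f e ≡ g e) → sumBelow f k ≡ suc (sumBelow g k)
sumBelow-suc-at f g (suc k) d d< fd≡ f≡g with d ≟ k
... | yes refl = cong₂ _+_ fd≡ (sumBelow-cong f g d (λ e e< → f≡g e (λ e≡d → <-irrefl e≡d e<)))
... | no d≢k = trans (cong₂ _+_ (f≡g k (d≢k ∘ sym)) (sumBelow-suc-at f g k d (≤∧≢⇒< (≤-pred d<) d≢k) fd≡ f≡g))
                     (+-suc (g k) (sumBelow g k))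

update : ∀ {A : Set} → (ℕ → A) → ℕ → A → ℕ → A
update f d c e with e ≟ d
... | yes _ = c
... | no _  = f e

update-elim : ∀ {A : Set} (P : ℕ → A → Set) {f d c} e → (e ≡ d → P e c) → (e ≢ d → P e (f e)) → P e (update f d c e)
update-elim P {d = d} e at-d elsewhere with e ≟ d
... | yes e≡d = at-d e≡d
... | no e≢d  = elsewhere e≢d

update-at : ∀ {A : Set} (f : ℕ → A) d c → update f d c d ≡ c
update-at f d c = update-elim (λ _ v → v ≡ c) d (λ _ → refl) (λ d≢d → ⊥-elim (d≢d refl))

update-other : ∀ {A : Set} (f : ℕ → A) d c e → e ≢ d → update f d c e ≡ f e
update-other f d c e e≢d = update-elim (λ e v → v ≡ f e) e (λ e≡d → ⊥-elim (e≢d e≡d)) (λ _ → refl)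

-- Monge tables with unit steps

IsMongeℕ : ℕ → (ℕ → ℕ → ℕ) → Set
IsMongeℕ N D = ∀ i j → i < N → j < N → (D i j , D (suc i) j) ⊑ (D i (suc j) , D (suc i) (suc j))

CrossGap : (ℕ → ℕ → ℕ) → ℕ → ℕ → ℕ → Set
CrossGap D i j c = D (suc i) j + D i (suc j) ≡ c + (D i j + D (suc i) (suc j))

crossGap-transpose : ∀ D i j c → CrossGap (λ a b → D b a) j i c → CrossGap D i j c
crossGap-transpose D i j c gap = trans (+-comm (D (suc i) j) (D i (suc j))) gap

monge-transpose : ∀ N D → IsMongeℕ N D → IsMongeℕ N (λ a b → D b a)
monge-transpose N D monge i j i< j< =
  subst (D j i + D (suc j) (suc i) ≤_) (+-comm (D (suc j) i) (D j (suc i))) (monge j i j< i<)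

record IsUnitStepMonge (N : ℕ) (D : ℕ → ℕ → ℕ) : Set where
  field
    monge      : IsMongeℕ N D
    vertical   : ∀ i j → i < N → j ≤ N → D (suc i) j ≡ suc (D i j) ⊎ D i j ≡ suc (D (suc i) j)
    horizontal : ∀ i j → i ≤ N → j < N → D i (suc j) ≡ suc (D i j) ⊎ D i j ≡ suc (D i (suc j))
    first-col  : ∀ i → i ≤ N → D i 0 ≡ i
    first-row  : ∀ j → j ≤ N → D 0 j ≡ j
    last-col   : ∀ i → i ≤ N → D i N ≡ N ∸ i
    last-row   : ∀ j → j ≤ N → D N j ≡ N ∸ j

transpose : ∀ {N D} → IsUnitStepMonge N D → IsUnitStepMonge N (λ a b → D b a)
transpose {N} {D} T = record
  { monge      = monge-transpose N D monge
  ; vertical   = λ i j i< j≤ → horizontal j i j≤ i<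
  ; horizontal = λ i j i≤ j< → vertical j i j< i≤
  ; first-col  = first-row
  ; first-row  = first-col
  ; last-col   = last-row
  ; last-row   = last-col
  }
  where open IsUnitStepMonge T

-- Along a row, D (1+i) j − D i j = ±1 can only switch from +1 to −1 (Monge), and the
-- borders force exactly one switch.
module RowJumps {N D} (T : IsUnitStepMonge N D) where
  open IsUnitStepMonge T

  Up Down : ℕ → ℕ → Set
  Up   i j = D (suc i) j ≡ suc (D i j)
  Down i j = D i j ≡ suc (D (suc i) j)

  ¬up∧down : ∀ {i j} → Up i j → Down i j → ⊥
  ¬up∧down up down = m≢1+m+n _ (trans (trans down (cong suc up)) (cong suc (+-comm 1 _)))

  ¬down∧up-next : ∀ i j → i < N → j < N → Down i j → Up i (suc j) → ⊥
  ¬down∧up-next i j i< j< down up = <-irrefl refl (≤-trans (s≤s (+-monoʳ-≤ p (n≤1+n q)))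
                                      (subst₂ (λ a b → a + b ≤ p + q) down up (monge i j i< j<)))
    where
      p q : ℕ
      p = D (suc i) j
      q = D i (suc j)

  down-next : ∀ i j → i < N → j < N → Down i j → Down i (suc j)
  down-next i j i< j< down with vertical i (suc j) i< j<
  ... | inj₁ up    = ⊥-elim (¬down∧up-next i j i< j< down up)
  ... | inj₂ down' = down'

  up-previous : ∀ i j → i < N → j < N → Up i (suc j) → Up i j
  up-previous i j i< j< up with vertical i j i< (<⇒≤ j<)
  ... | inj₁ up'  = up'
  ... | inj₂ down = ⊥-elim (¬down∧up-next i j i< j< down up)

  up-below : ∀ i j k → i < N → j ≤ k → k ≤ N → Up i k → Up i j
  up-below i j k i< j≤k k≤ up with m≤n⇒m<n∨m≡n j≤k
  up-below i j k       i< _ _  up | inj₂ refl      = up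
  up-below i j zero    i< _ _  up | inj₁ ()
  up-below i j (suc k) i< _ k< up | inj₁ (s≤s j≤k) = up-below i j k i< j≤k (<⇒≤ k<) (up-previous i k i< k< up)

  down-above : ∀ i j k → i < N → j ≤ k → k ≤ N → Down i j → Down i k
  down-above i j k i< j≤k k≤ down with m≤n⇒m<n∨m≡n j≤k
  down-above i j k       i< _ _  down | inj₂ refl      = down
  down-above i j zero    i< _ _  down | inj₁ ()
  down-above i j (suc k) i< _ k< down | inj₁ (s≤s j≤k) = down-next i k i< k< (down-above i j k i< j≤k (<⇒≤ k<) down)

  up-up⇒gap0 : ∀ {i j} → Up i j → Up i (suc j) → CrossGap D i j 0
  up-up⇒gap0 {i} {j} up up' =
    trans (cong (_+ D i (suc j)) up) (trans (sym (+-suc (D i j) (D i (suc j)))) (cong (D i j +_) (sym up')))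

  down-down⇒gap0 : ∀ {i j} → Down i j → Down i (suc j) → CrossGap D i j 0
  down-down⇒gap0 {i} {j} down down' =
    trans (cong (D (suc i) j +_) down') (trans (+-suc (D (suc i) j) _) (cong (_+ D (suc i) (suc j)) (sym down)))

  up-down⇒gap2 : ∀ {i j} → Up i j → Down i (suc j) → CrossGap D i j 2
  up-down⇒gap2 {i} {j} up down = trans (cong₂ _+_ up down) (cong suc (+-suc (D i j) _))

  gap0⊎gap2 : ∀ i j → i < N → j < N → CrossGap D i j 0 ⊎ CrossGap D i j 2
  gap0⊎gap2 i j i< j< with vertical i j i< (<⇒≤ j<) | vertical i (suc j) i< j<
  ... | inj₁ up   | inj₁ up'   = inj₁ (up-up⇒gap0 up up')
  ... | inj₁ up   | inj₂ down' = inj₂ (up-down⇒gap2 up down')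
  ... | inj₂ down | inj₁ up'   = ⊥-elim (¬down∧up-next i j i< j< down up')
  ... | inj₂ down | inj₂ down' = inj₁ (down-down⇒gap0 down down')

  up-first : ∀ i → i < N → Up i 0
  up-first i i< = trans (first-col (suc i) i<) (cong suc (sym (first-col i (<⇒≤ i<))))

  down-last : ∀ i → i < N → Down i N
  down-last i i< = trans (last-col i (<⇒≤ i<)) (trans (+-∸-assoc 1 i<) (cong suc (sym (last-col (suc i) i<))))

  jump-below : ∀ i → i < N → ∀ k → k ≤ N → Down i k → Σ ℕ λ j → j < k × Up i j × Down i (suc j)
  jump-below i i< zero _ down = ⊥-elim (¬up∧down (up-first i i<) down)
  jump-below i i< (suc k) k< down with vertical i k i< (<⇒≤ k<)
  ... | inj₁ up    = k , n<1+n k , up , down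
  ... | inj₂ down' with jump-below i i< k (<⇒≤ k<) down'
  ...   | j , j<k , jump = j , m<n⇒m<1+n j<k , jump

  unique-jump : ∀ i → i < N → Σ ℕ λ j → j < N × CrossGap D i j 2 × (∀ j' → j' < N → j' ≢ j → CrossGap D i j' 0)
  unique-jump i i< with jump-below i i< N ≤-refl (down-last i i<)
  ... | j* , j*< , up , down = j* , j*< , up-down⇒gap2 up down , elsewhere
    where
      elsewhere : ∀ j → j < N → j ≢ j* → CrossGap D i j 0
      elsewhere j j< j≢j* with <-cmp j j*
      ... | tri< j<j* _ _ = up-up⇒gap0 (up-below i j j* i< (<⇒≤ j<j*) (<⇒≤ j*<) up) (up-below i (suc j) j* i< j<j* (<⇒≤ j*<) up)
      ... | tri≈ _ j≡j* _ = ⊥-elim (j≢j* j≡j*)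
      ... | tri> _ _ j*<j = down-down⇒gap0 (down-above i (suc j*) j i< j*<j (<⇒≤ j<) down)
                                           (down-above i (suc j*) (suc j) i< (≤-trans j*<j (n≤1+n j)) j< down)

ℕtoℚ-+ : ∀ a b → ℕtoℚ (a + b) ≡ ℕtoℚ a ℚ.+ ℕtoℚ b
ℕtoℚ-+ a b = toℚᵘ-injective (ℚᵘ.≃-trans (toℚᵘ-fromℚᵘ (ℕtoℚᵘ (a + b)))
  (ℚᵘ.≃-sym (ℚᵘ.≃-trans (toℚᵘ-homo-+ (ℕtoℚ a) (ℕtoℚ b))
    (ℚᵘ.≃-trans (ℚᵘ.+-cong (toℚᵘ-fromℚᵘ (ℕtoℚᵘ a)) (toℚᵘ-fromℚᵘ (ℕtoℚᵘ b))) ℚᵘ-+))))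
  where
    ℕtoℚᵘ : ℕ → ℚᵘ.ℚᵘ
    ℕtoℚᵘ k = ℚᵘ.mkℚᵘ (ℤ.+ k) 0
    ℚᵘ-+ : (ℕtoℚᵘ a ℚᵘ.+ ℕtoℚᵘ b) ℚᵘ.≃ ℕtoℚᵘ (a + b)
    ℚᵘ-+ = ℚᵘ.*≡* (trans (ℤ.*-identityʳ _) (trans (cong₂ ℤ._+_ (ℤ.*-identityʳ (ℤ.+ a)) (ℤ.*-identityʳ (ℤ.+ b))) (sym (ℤ.*-identityʳ _))))

density-Dmat : ∀ D i j c → CrossGap D i j c → density (Dmat D) i j ≡ ℕtoℚ c
density-Dmat D i j c gap =
  trans (cong (λ t → (t ℚ.- ℕtoℚ (D i j)) ℚ.- ℕtoℚ (D (suc i) (suc j)))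
          (trans (sym (ℕtoℚ-+ (D (suc i) j) (D i (suc j))))
          (trans (cong ℕtoℚ gap) (trans (ℕtoℚ-+ c _) (cong (ℕtoℚ c ℚ.+_) (ℕtoℚ-+ (D i j) (D (suc i) (suc j))))))))
        (solveℚ 3 (λ C P R → ((C :+ℚ (P :+ℚ R)) :-ℚ P) :-ℚ R :=ℚ C) refl (ℕtoℚ c) (ℕtoℚ (D i j)) (ℕtoℚ (D (suc i) (suc j))))

-- The shifts −a + b of M_G cancel in the density.
density-Mmat : ∀ D i j → density (Mmat D) i j ≡ ½ ℚ.* density (Dmat D) i j
density-Mmat D i j =
  trans (cong₂ (λ i' j' → ((½ ℚ.* ((ℕtoℚ (D (suc i) j) ℚ.- i') ℚ.+ ℕtoℚ j) ℚ.+ ½ ℚ.* ((ℕtoℚ (D i (suc j)) ℚ.- ℕtoℚ i) ℚ.+ j'))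
                            ℚ.- ½ ℚ.* ((ℕtoℚ (D i j) ℚ.- ℕtoℚ i) ℚ.+ ℕtoℚ j))
                            ℚ.- ½ ℚ.* ((ℕtoℚ (D (suc i) (suc j)) ℚ.- i') ℚ.+ j'))
               (ℕtoℚ-+ 1 i) (ℕtoℚ-+ 1 j))
        (solveℚ 8 (λ h a b c d i j o →
                     ((h :*ℚ ((a :-ℚ (o :+ℚ i)) :+ℚ j) :+ℚ h :*ℚ ((b :-ℚ i) :+ℚ (o :+ℚ j))) :-ℚ h :*ℚ ((c :-ℚ i) :+ℚ j))
                       :-ℚ h :*ℚ ((d :-ℚ (o :+ℚ i)) :+ℚ (o :+ℚ j))
                     :=ℚ h :*ℚ (((a :+ℚ b) :-ℚ c) :-ℚ d)) refl
           ½ (ℕtoℚ (D (suc i) j)) (ℕtoℚ (D i (suc j))) (ℕtoℚ (D i j)) (ℕtoℚ (D (suc i) (suc j))) (ℕtoℚ i) (ℕtoℚ j) 1ℚ)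

module UnitMonge {N D} (T : IsUnitStepMonge N D) where
  open IsUnitStepMonge T
  open RowJumps

  density-0 : ∀ {i j} → CrossGap D i j 0 → density (Mmat D) i j ≡ 0ℚ
  density-0 {i} {j} gap = trans (density-Mmat D i j) (cong (½ ℚ.*_) (density-Dmat D i j 0 gap))

  density-1 : ∀ {i j} → CrossGap D i j 2 → density (Mmat D) i j ≡ 1ℚ
  density-1 {i} {j} gap = trans (density-Mmat D i j) (cong (½ ℚ.*_) (density-Dmat D i j 2 gap))

  isMonge : IsMonge N N (Dmat D)
  isMonge i j i< j< = [ nonneg 0 (ℚ.*≤* (ℤ.+≤+ z≤n)) , nonneg 2 (ℚ.*≤* (ℤ.+≤+ z≤n)) ]′ (gap0⊎gap2 T i j i< j<)
    where
      nonneg : ∀ c → 0ℚ ℚ.≤ ℕtoℚ c → CrossGap D i j c → 0ℚ ℚ.≤ density (Dmat D) i j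
      nonneg c 0≤c gap = subst (0ℚ ℚ.≤_) (sym (density-Dmat D i j c gap)) 0≤c

  isUnitMonge : IsUnitMonge N N (Mmat D)
  isUnitMonge = entries , rows , cols
    where
      entries : ∀ i j → i < N → j < N → density (Mmat D) i j ≡ 0ℚ ⊎ density (Mmat D) i j ≡ 1ℚ
      entries i j i< j< = Sum.map density-0 density-1 (gap0⊎gap2 T i j i< j<)

      rows : ∀ i → i < N → Σ ℕ λ j → j < N × density (Mmat D) i j ≡ 1ℚ × (∀ j' → j' < N → j' ≢ j → density (Mmat D) i j' ≡ 0ℚ)
      rows i i< = let j , j< , gap2 , gap0 = unique-jump T i i< in
        j , j< , density-1 gap2 , λ j' j'< j'≢j → density-0 (gap0 j' j'< j'≢j)

      cols : ∀ j → j < N → Σ ℕ λ i → i < N × density (Mmat D) i j ≡ 1ℚ × (∀ i' → i' < N → i' ≢ i → density (Mmat D) i' j ≡ 0ℚ)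
      cols j j< = let i , i< , gap2 , gap0 = unique-jump (transpose T) j j< in
        i , i< , density-1 (crossGap-transpose D i j 2 gap2) ,
        λ i' i'< i'≢i → density-0 (crossGap-transpose D i' j 0 (gap0 i' i'< i'≢i))

  isSimple : IsSimple N N (Mmat D)
  isSimple = last-row-0 , first-col-0
    where
      last-row-0 : ∀ j → j ≤ N → Mmat D N j ≡ 0ℚ
      last-row-0 j j≤ =
        trans (cong₂ (λ t u → ½ ℚ.* ((t ℚ.- u) ℚ.+ ℕtoℚ j)) (cong ℕtoℚ (last-row j j≤))
                     (trans (cong ℕtoℚ (sym (m∸n+n≡m j≤))) (ℕtoℚ-+ (N ∸ j) j)))
              (cong (½ ℚ.*_) (solveℚ 2 (λ T J → (T :-ℚ (T :+ℚ J)) :+ℚ J :=ℚ conℚ 0ℚ) refl (ℕtoℚ (N ∸ j)) (ℕtoℚ j)))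
      first-col-0 : ∀ i → i ≤ N → Mmat D i 0 ≡ 0ℚ
      first-col-0 i i≤ =
        trans (cong (λ t → ½ ℚ.* ((ℕtoℚ t ℚ.- ℕtoℚ i) ℚ.+ ℕtoℚ 0)) (first-col i i≤))
              (cong (½ ℚ.*_) (solveℚ 1 (λ I → (I :-ℚ I) :+ℚ conℚ 0ℚ :=ℚ conℚ 0ℚ) refl (ℕtoℚ i)))

-- Distances in a slice

module Slice (n m : ℕ) (S : ℕ → ℕ → Bool) (π : ℕ → Point) (stπ : Staircase n m π) where
  N : ℕ
  N = n + m

  diagIdx-staircase : ∀ {σ} → Staircase n m σ → ∀ e → e ≤ N → diagIdx m (σ e) ≡ e
  diagIdx-staircase {σ} st e e≤ = diagIdx-onDiag (σ e) (onDiag st e e≤)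

  staircase∈Region : ∀ σ τ → Staircase n m τ → (∀ e → e ≤ N → π e ⪯ τ e) → (∀ e → e ≤ N → τ e ⪯ σ e) →
                     ∀ e → e ≤ N → InSAG n m π σ (τ e)
  staircase∈Region σ τ stτ π⪯τ τ⪯σ e e≤ =
    inGrid stτ e e≤ , subst (λ k → π k ⪯ τ e × τ e ⪯ σ k) (sym (diagIdx-staircase stτ e e≤)) (π⪯τ e e≤ , τ⪯σ e e≤)

  DistanceTable : (ℕ → Point) → Set
  DistanceTable σ = Σ (ℕ → ℕ → ℕ) λ D →
    (∀ a b → a ≤ N → b ≤ N → IsDist n m π σ S (π a) (σ b) (D a b)) × IsMongeℕ N D

  module Along (σ τ : ℕ → Point) (stτ : Staircase n m τ) (τ∈ : ∀ e → e ≤ N → InSAG n m π σ (τ e)) where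
    open Walks n m S π σ

    walk-along : ∀ k a → a + k ≤ N → Wk (τ a) (τ (a + k)) k
    walk-along zero a a≤ = castᵗ (cong τ (sym (+-identityʳ a))) (here (τ∈ a (≤-trans (m≤m+n a 0) a≤)))
    walk-along (suc k) a a+k< =
      step (τ∈ a (<⇒≤ a<N)) (Step⇒AGEdge (next stτ a a<N))
           (castᵗ (cong τ (sym (+-suc a k))) (walk-along k (suc a) (subst (_≤ N) (+-suc a k) a+k<)))
      where
        a<N : a < N
        a<N = <-≤-trans (m<m+n a z<s) a+k<

    walk-forward : ∀ a b → a ≤ b → b ≤ N → Wk (τ a) (τ b) (b ∸ a)
    walk-forward a b a≤b b≤N =
      castᵗ (cong τ (m+[n∸m]≡n a≤b)) (walk-along (b ∸ a) a (subst (_≤ N) (sym (m+[n∸m]≡n a≤b)) b≤N))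

    walk-backward : ∀ a b → b ≤ a → a ≤ N → Wk (τ a) (τ b) (a ∸ b)
    walk-backward a b b≤a a≤N = reverse (walk-forward b a b≤a a≤N)

  flat-table : ∀ σ → Staircase n m σ → (∀ e → e ≤ N → σ e ≡ π e) → DistanceTable σ
  flat-table σ stσ σ≡π = (λ a b → ∣ a - b ∣) , dist , (λ i j _ _ → ∣-∣-monge i j)
    where
      open Walks n m S π σ
      open Along σ π stπ (staircase∈Region σ π stπ (λ _ _ → inj₁ refl) (λ e e≤ → inj₁ (sym (σ≡π e e≤))))

      dist : ∀ a b → a ≤ N → b ≤ N → IsDist n m π σ S (π a) (σ b) ∣ a - b ∣
      dist a b a≤ b≤ = walk (≤-total a b) , λ w wk → lower-bound wk
        where
          walk : a ≤ b ⊎ b ≤ a → Wk (π a) (σ b) ∣ a - b ∣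
          walk (inj₁ a≤b) = castᵗ (sym (σ≡π b b≤)) (castʷ (sym (m≤n⇒∣m-n∣≡n∸m a≤b)) (walk-forward a b a≤b b≤))
          walk (inj₂ b≤a) = castᵗ (sym (σ≡π b b≤)) (castʷ (sym (m≤n⇒∣n-m∣≡n∸m b≤a)) (walk-backward a b b≤a a≤))
          lower-bound : ∀ {w} → Wk (π a) (σ b) w → ∣ a - b ∣ ≤ w
          lower-bound {w} wk with diagIdx-bounds wk
          ... | b≤a+w , a≤b+w rewrite diagIdx-staircase stπ a a≤ | diagIdx-staircase stσ b b≤ = ∣m-n∣≤ a b w b≤a+w a≤b+w

  record Corner (σ : ℕ → Point) : Set where
    field
      d₀ x y  : ℕ
      d<N     : suc d₀ < N
      σ-left  : σ d₀ ≡ (x , suc y)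
      σ-outer : σ (suc d₀) ≡ (suc x , suc y)
      σ-below : σ (suc (suc d₀)) ≡ (suc x , y)
      π≺outer : π (suc d₀) ≺ σ (suc d₀)

  module RemoveCorner (σ : ℕ → Point) (stσ : Staircase n m σ) (π⪯σ : ∀ e → e ≤ N → π e ⪯ σ e)
                      (corner : Corner σ) where
    open Corner corner

    d : ℕ
    d = suc d₀

    left outer below inner : Point
    left  = (x , suc y)
    outer = (suc x , suc y)
    below = (suc x , y)
    inner = (x , y)

    σ⁻ : ℕ → Point
    σ⁻ = update σ d inner

    module W  = Walks n m S π σ
    module W⁻ = Walks n m S π σ⁻

    d≤N : d ≤ N
    d≤N = <⇒≤ d<N

    d₀≤N : d₀ ≤ N
    d₀≤N = ≤-trans (n≤1+n d₀) d≤N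

    outer-onDiag : OnDiag m d outer
    outer-onDiag = subst (OnDiag m d) σ-outer (onDiag stσ d d≤N)

    inner-onDiag : OnDiag m d inner
    inner-onDiag = suc-injective (trans outer-onDiag (+-suc d y))

    outer-inGrid : InGrid n m outer
    outer-inGrid = subst (InGrid n m) σ-outer (inGrid stσ d d≤N)

    diagIdx-left : diagIdx m left ≡ d₀
    diagIdx-left = diagIdx-onDiag left (subst (OnDiag m d₀) σ-left (onDiag stσ d₀ d₀≤N))

    diagIdx-outer : diagIdx m outer ≡ d
    diagIdx-outer = diagIdx-onDiag outer outer-onDiag

    diagIdx-below : diagIdx m below ≡ suc d
    diagIdx-below = diagIdx-onDiag below (subst (OnDiag m (suc d)) σ-below (onDiag stσ (suc d) d<N))

    σ⁻-d : σ⁻ d ≡ inner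
    σ⁻-d = update-at σ d inner

    σ⁻-other : ∀ e → e ≢ d → σ⁻ e ≡ σ e
    σ⁻-other = update-other σ d inner

    σ⁻-d₀ : σ⁻ d₀ ≡ left
    σ⁻-d₀ = trans (σ⁻-other d₀ (1+n≢n ∘ sym)) σ-left

    σ⁻-suc-d : σ⁻ (suc d) ≡ below
    σ⁻-suc-d = trans (σ⁻-other (suc d) 1+n≢n) σ-below

    stσ⁻ : Staircase n m σ⁻
    stσ⁻ = record
      { inGrid = λ e e≤ → update-elim (λ _ p → InGrid n m p) e
                            (λ _ → ≤-trans (n≤1+n x) (proj₁ outer-inGrid) , ≤-trans (n≤1+n y) (proj₂ outer-inGrid))
                            (λ _ → inGrid stσ e e≤)
      ; onDiag = λ e e≤ → update-elim (OnDiag m) e (λ { refl → inner-onDiag }) (λ _ → onDiag stσ e e≤)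
      ; next   = λ e e< → steps e e< (e ≟ d₀) (e ≟ d)
      }
      where
        steps : ∀ e → e < N → Dec (e ≡ d₀) → Dec (e ≡ d) → Step (σ⁻ e) (σ⁻ (suc e))
        steps e _  (yes refl) _          = subst₂ Step (sym σ⁻-d₀) (sym σ⁻-d) (inj₂ refl)
        steps e _  (no _)     (yes refl) = subst₂ Step (sym σ⁻-d) (sym σ⁻-suc-d) (inj₁ refl)
        steps e e< (no e≢d₀)  (no e≢d)   =
          subst₂ Step (sym (σ⁻-other e e≢d)) (sym (σ⁻-other (suc e) (e≢d₀ ∘ suc-injective))) (next stσ e e<)

    π⪯σ⁻ : ∀ e → e ≤ N → π e ⪯ σ⁻ e
    π⪯σ⁻ e e≤ = update-elim (λ e p → π e ⪯ p) e (λ { refl → π⪯inner }) (λ _ → π⪯σ e e≤)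
      where
        π⪯inner : π d ⪯ inner
        π⪯inner = ≺-suc⇒⪯ (subst (π d ≺_) σ-outer π≺outer) (onDiag stπ d d≤N) outer-onDiag

    Region⁻⊆Region : ∀ p → W⁻.Region p → W.Region p
    Region⁻⊆Region p (p∈G , π⪯p , p⪯σ⁻) = p∈G , π⪯p , ⪯σ⁻⇒⪯σ (diagIdx m p) p⪯σ⁻
      where
        ⪯σ⁻⇒⪯σ : ∀ e → p ⪯ σ⁻ e → p ⪯ σ e
        ⪯σ⁻⇒⪯σ e = update-elim (λ e q → p ⪯ q → p ⪯ σ e) e
          (λ { refl p⪯inner → subst (p ⪯_) (sym σ-outer) (inj₂ (⪯⇒≺-suc p⪯inner)) }) (λ _ p⪯ → p⪯)

    Region⊆Region⁻ : ∀ p → W.Region p → p ≢ outer → W⁻.Region p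
    Region⊆Region⁻ p (p∈G , π⪯p , p⪯σ) p≢outer = p∈G , π⪯p ,
      update-elim (λ e q → p ⪯ σ e → p ⪯ q) (diagIdx m p) at-d (λ _ p⪯ → p⪯) p⪯σ
      where
        at-d : diagIdx m p ≡ d → p ⪯ σ (diagIdx m p) → p ⪯ inner
        at-d idx≡d p⪯σ with subst (p ⪯_) σ-outer (subst (λ e → p ⪯ σ e) idx≡d p⪯σ)
        ... | inj₁ p≡outer = ⊥-elim (p≢outer p≡outer)
        ... | inj₂ p≺outer = ≺-suc⇒⪯ p≺outer (onDiag-diagIdx p (proj₂ p∈G) idx≡d) outer-onDiag

    outer∉Region⁻ : ¬ W⁻.Region outer
    outer∉Region⁻ (_ , _ , outer⪯) = 1+n≰n (⪯⇒≤₁ (subst (outer ⪯_) σ⁻-d (subst (λ e → outer ⪯ σ⁻ e) diagIdx-outer outer⪯)))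

    σ⁻∈Region⁻ : ∀ e → e ≤ N → W⁻.Region (σ⁻ e)
    σ⁻∈Region⁻ = staircase∈Region σ⁻ σ⁻ stσ⁻ π⪯σ⁻ (λ _ _ → inj₁ refl)

    π∈Region⁻ : ∀ e → e ≤ N → W⁻.Region (π e)
    π∈Region⁻ = staircase∈Region σ⁻ π stπ (λ _ _ → inj₁ refl) π⪯σ⁻

    left∈Region⁻ : W⁻.Region left
    left∈Region⁻ = subst W⁻.Region σ⁻-d₀ (σ⁻∈Region⁻ d₀ d₀≤N)

    below∈Region⁻ : W⁻.Region below
    below∈Region⁻ = subst W⁻.Region σ⁻-suc-d (σ⁻∈Region⁻ (suc d) d<N)

    inner∈Region⁻ : W⁻.Region inner
    inner∈Region⁻ = subst W⁻.Region σ⁻-d (σ⁻∈Region⁻ d d≤N)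

    outer∈Region : W.Region outer
    outer∈Region = subst W.Region σ-outer (staircase∈Region σ σ stσ π⪯σ (λ _ _ → inj₁ refl) d d≤N)

    data OuterNeighbour : Point → ℕ → Set where
      left-nb  : OuterNeighbour left 1
      below-nb : OuterNeighbour below 1
      inner-nb : S x y ≡ true → OuterNeighbour inner 0

    Region-x≤σ : ∀ {p k r} → W.Region p → diagIdx m p ≡ k → σ k ≡ r → proj₁ p ≤ proj₁ r
    Region-x≤σ (_ , _ , p⪯) refl refl = ⪯⇒≤₁ p⪯

    outer-neighbour : ∀ {q e} → AGEdge S outer q e → W.Region q → OuterNeighbour q e
    outer-neighbour (horiz _ _)   q∈ = ⊥-elim (1+n≰n (Region-x≤σ q∈ diagIdx-below σ-below))
    outer-neighbour (horiz⁻ _ _)  _  = left-nb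
    outer-neighbour (vert _ _)    q∈ = ⊥-elim (1+n≰n (Region-x≤σ q∈ diagIdx-left σ-left))
    outer-neighbour (vert⁻ _ _)   _  = below-nb
    outer-neighbour (diag _ _ _)  q∈ = ⊥-elim (1+n≰n (Region-x≤σ q∈ diagIdx-outer σ-outer))
    outer-neighbour (diag⁻ _ _ s) _  = inner-nb s

    neighbour∈Region⁻ : ∀ {q e} → OuterNeighbour q e → W⁻.Region q
    neighbour∈Region⁻ left-nb      = left∈Region⁻
    neighbour∈Region⁻ below-nb     = below∈Region⁻
    neighbour∈Region⁻ (inner-nb _) = inner∈Region⁻

    neighbours-joined : ∀ {p q e₁ e₂} → OuterNeighbour p e₁ → OuterNeighbour q e₂ →
                        Σ ℕ λ w → w ≤ e₁ + e₂ × W⁻.Wk p q w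
    neighbours-joined left-nb      left-nb      = 0 , z≤n , here left∈Region⁻
    neighbours-joined left-nb      below-nb     = 2 , ≤-refl , step left∈Region⁻ (vert⁻ x y) (step inner∈Region⁻ (horiz x y) (here below∈Region⁻))
    neighbours-joined left-nb      (inner-nb _) = 1 , ≤-refl , step left∈Region⁻ (vert⁻ x y) (here inner∈Region⁻)
    neighbours-joined below-nb     left-nb      = 2 , ≤-refl , step below∈Region⁻ (horiz⁻ x y) (step inner∈Region⁻ (vert x y) (here left∈Region⁻))
    neighbours-joined below-nb     below-nb     = 0 , z≤n , here below∈Region⁻
    neighbours-joined below-nb     (inner-nb _) = 1 , ≤-refl , step below∈Region⁻ (horiz⁻ x y) (here inner∈Region⁻)
    neighbours-joined (inner-nb _) left-nb      = 1 , ≤-refl , step inner∈Region⁻ (vert x y) (here left∈Region⁻)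
    neighbours-joined (inner-nb _) below-nb     = 1 , ≤-refl , step inner∈Region⁻ (horiz x y) (here below∈Region⁻)
    neighbours-joined (inner-nb _) (inner-nb _) = 0 , z≤n , here inner∈Region⁻

    -- A walk through outer enters and leaves it via two of its neighbours, which are
    -- already joined inside the smaller region at no greater cost.
    avoid-outer : ∀ {p q w} → W.Wk p q w → W⁻.Region p → W⁻.Region q → Σ ℕ λ w⁻ → w⁻ ≤ w × W⁻.Wk p q w⁻
    avoid-outer (here _) p∈ _ = 0 , z≤n , here p∈
    avoid-outer (step {q = r} {e = e} _ edge walk) p∈ q∈ with r ≟ₚ outer
    ... | no r≢outer with avoid-outer walk (Region⊆Region⁻ r (W.source walk) r≢outer) q∈
    ...   | w⁻ , w⁻≤ , walk⁻ = e + w⁻ , +-monoʳ-≤ e w⁻≤ , step p∈ edge walk⁻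
    avoid-outer (step _ _ (here _)) _ q∈ | yes refl = ⊥-elim (outer∉Region⁻ q∈)
    avoid-outer (step {p} {e = e} _ edge (step {e = e₂} {w = w₂} _ edge₂ walk)) p∈ q∈ | yes refl
      with neighbours-joined (outer-neighbour (AGEdge-sym edge) (Region⁻⊆Region p p∈)) (outer-neighbour edge₂ (W.source walk))
         | avoid-outer walk (neighbour∈Region⁻ (outer-neighbour edge₂ (W.source walk))) q∈
    ... | w₀ , w₀≤ , walk₀ | w₁ , w₁≤ , walk₁ =
      w₀ + w₁ , ≤-trans (+-mono-≤ w₀≤ w₁≤) (≤-reflexive (+-assoc e e₂ w₂)) , walk₀ W⁻.++ walk₁

    module Extend (D⁻ : ℕ → ℕ → ℕ)
                  (dist⁻ : ∀ a b → a ≤ N → b ≤ N → IsDist n m π σ⁻ S (π a) (σ⁻ b) (D⁻ a b))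
                  (monge⁻ : IsMongeℕ N D⁻) where

      -- Only column d changes: outer is reached from inner through the zero-weight
      -- diagonal if there is one, and otherwise from left or from below.
      outerDist : Bool → ℕ → ℕ
      outerDist true  a = D⁻ a d
      outerDist false a = suc (D⁻ a d₀ ⊓ D⁻ a (suc d))

      D : Bool → ℕ → ℕ → ℕ
      D s a = update (D⁻ a) d (outerDist s a)

      walk⁻ : ∀ a b → a ≤ N → b ≤ N → W⁻.Wk (π a) (σ⁻ b) (D⁻ a b)
      walk⁻ a b a≤ b≤ = proj₁ (dist⁻ a b a≤ b≤)

      minimal⁻ : ∀ a b → a ≤ N → b ≤ N → ∀ {w} → W⁻.Wk (π a) (σ⁻ b) w → D⁻ a b ≤ w
      minimal⁻ a b a≤ b≤ walk = proj₂ (dist⁻ a b a≤ b≤) _ walk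

      D⁻-inner≤1+left : ∀ a → a ≤ N → D⁻ a d ≤ suc (D⁻ a d₀)
      D⁻-inner≤1+left a a≤ = ≤-trans
        (minimal⁻ a d a≤ d≤N (W⁻.castᵗ (sym σ⁻-d) (W⁻.castᵗ σ⁻-d₀ (walk⁻ a d₀ a≤ d₀≤N) W⁻.▷ vert⁻ x y ∶ inner∈Region⁻)))
        (≤-reflexive (+-comm _ 1))

      D⁻-inner≤1+below : ∀ a → a ≤ N → D⁻ a d ≤ suc (D⁻ a (suc d))
      D⁻-inner≤1+below a a≤ = ≤-trans
        (minimal⁻ a d a≤ d≤N (W⁻.castᵗ (sym σ⁻-d) (W⁻.castᵗ σ⁻-suc-d (walk⁻ a (suc d) a≤ d<N) W⁻.▷ horiz⁻ x y ∶ inner∈Region⁻)))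
        (≤-reflexive (+-comm _ 1))

      walk-to-outer : ∀ s → S x y ≡ s → ∀ a → a ≤ N → W.Wk (π a) outer (outerDist s a)
      walk-to-outer true S≡ a a≤ = W.castʷ (+-identityʳ _)
        (Walk-mono Region⁻⊆Region (W⁻.castᵗ σ⁻-d (walk⁻ a d a≤ d≤N)) W.▷ diag x y S≡ ∶ outer∈Region)
      walk-to-outer false S≡ a a≤ with ⊓-sel (D⁻ a d₀) (D⁻ a (suc d))
      ... | inj₁ ⊓≡left = W.castʷ (trans (+-comm _ 1) (cong suc (sym ⊓≡left)))
        (Walk-mono Region⁻⊆Region (W⁻.castᵗ σ⁻-d₀ (walk⁻ a d₀ a≤ d₀≤N)) W.▷ horiz x (suc y) ∶ outer∈Region)
      ... | inj₂ ⊓≡below = W.castʷ (trans (+-comm _ 1) (cong suc (sym ⊓≡below)))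
        (Walk-mono Region⁻⊆Region (W⁻.castᵗ σ⁻-suc-d (walk⁻ a (suc d) a≤ d<N)) W.▷ vert (suc x) y ∶ outer∈Region)

      leave-outer : ∀ {q w} → W.Wk outer q w → W⁻.Region q →
                    Σ Point λ r → Σ ℕ λ e → Σ ℕ λ w' → OuterNeighbour r e × W⁻.Wk r q w' × e + w' ≤ w
      leave-outer (here _) q∈ = ⊥-elim (outer∉Region⁻ q∈)
      leave-outer (step {e = e} _ edge walk) q∈ with avoid-outer walk (neighbour∈Region⁻ (outer-neighbour edge (W.source walk))) q∈
      ... | w' , w'≤ , walk' = _ , e , w' , outer-neighbour edge (W.source walk) , walk' , +-monoʳ-≤ e w'≤

      outerDist-≤-via : ∀ s → S x y ≡ s → ∀ a → a ≤ N → ∀ {r e w} → OuterNeighbour r e → W⁻.Wk (π a) r w →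
                        outerDist s a ≤ e + w
      outerDist-≤-via true _ a a≤ left-nb walk =
        ≤-trans (D⁻-inner≤1+left a a≤) (s≤s (minimal⁻ a d₀ a≤ d₀≤N (W⁻.castᵗ (sym σ⁻-d₀) walk)))
      outerDist-≤-via true _ a a≤ below-nb walk =
        ≤-trans (D⁻-inner≤1+below a a≤) (s≤s (minimal⁻ a (suc d) a≤ d<N (W⁻.castᵗ (sym σ⁻-suc-d) walk)))
      outerDist-≤-via true _ a a≤ (inner-nb _) walk = minimal⁻ a d a≤ d≤N (W⁻.castᵗ (sym σ⁻-d) walk)
      outerDist-≤-via false _ a a≤ left-nb walk =
        s≤s (≤-trans (m⊓n≤m _ _) (minimal⁻ a d₀ a≤ d₀≤N (W⁻.castᵗ (sym σ⁻-d₀) walk)))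
      outerDist-≤-via false _ a a≤ below-nb walk =
        s≤s (≤-trans (m⊓n≤n _ _) (minimal⁻ a (suc d) a≤ d<N (W⁻.castᵗ (sym σ⁻-suc-d) walk)))
      outerDist-≤-via false S≡ a a≤ (inner-nb S≡true) walk with trans (sym S≡) S≡true
      ... | ()

      outerDist-minimal : ∀ s → S x y ≡ s → ∀ a → a ≤ N → ∀ {w} → W.Wk (π a) outer w → outerDist s a ≤ w
      outerDist-minimal s S≡ a a≤ walk with leave-outer (W.reverse walk) (π∈Region⁻ a a≤)
      ... | _ , _ , _ , nb , walk' , e+w'≤ = ≤-trans (outerDist-≤-via s S≡ a a≤ nb (W⁻.reverse walk')) e+w'≤

      dist : ∀ s → S x y ≡ s → ∀ a b → a ≤ N → b ≤ N → IsDist n m π σ S (π a) (σ b) (D s a b)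
      dist s S≡ a b a≤ b≤ = update-elim (λ b v → IsDist n m π σ S (π a) (σ b) v) b
        (λ { refl → W.castᵗ (sym σ-outer) (walk-to-outer s S≡ a a≤) ,
                    λ _ walk → outerDist-minimal s S≡ a a≤ (W.castᵗ σ-outer walk) })
        (λ b≢d → W.castᵗ (σ⁻-other b b≢d) (Walk-mono Region⁻⊆Region (walk⁻ a b a≤ b≤)) ,
                 λ _ walk → unchanged (avoid-outer (W.castᵗ (sym (σ⁻-other b b≢d)) walk) (π∈Region⁻ a a≤) (σ⁻∈Region⁻ b b≤)))
        where
          unchanged : ∀ {w} → Σ ℕ (λ w⁻ → w⁻ ≤ w × W⁻.Wk (π a) (σ⁻ b) w⁻) → D⁻ a b ≤ w
          unchanged (_ , w⁻≤ , walk⁻) = ≤-trans (minimal⁻ a b a≤ b≤ walk⁻) w⁻≤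

      column : (ℕ → ℕ → ℕ) → ℕ → ℕ → ℕ × ℕ
      column E i b = (E i b , E (suc i) b)

      monge : ∀ s → IsMongeℕ N (D s)
      monge true i j i< j< = subst₂ _⊑_ (sym (unchanged j)) (sym (unchanged (suc j))) (monge⁻ i j i< j<)
        where
          unchanged : ∀ b → column (D true) i b ≡ column D⁻ i b
          unchanged b = cong₂ _,_ (update-elim (λ b v → v ≡ D⁻ i b) b (λ { refl → refl }) (λ _ → refl))
                                  (update-elim (λ b v → v ≡ D⁻ (suc i) b) b (λ { refl → refl }) (λ _ → refl))
      monge false i j i< j< = cases j j< (j ≟ d₀) (j ≟ d)
        where
          column-other : ∀ b → b ≢ d → column (D false) i b ≡ column D⁻ i b
          column-other b b≢d = cong₂ _,_ (update-other (D⁻ i) d _ b b≢d) (update-other (D⁻ (suc i)) d _ b b≢d)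
          column-d : column (D false) i d ≡ (outerDist false i , outerDist false (suc i))
          column-d = cong₂ _,_ (update-at (D⁻ i) d _) (update-at (D⁻ (suc i)) d _)
          left⊑below : column D⁻ i d₀ ⊑ column D⁻ i (suc d)
          left⊑below = ⊑-trans {column D⁻ i d₀} {column D⁻ i d} {column D⁻ i (suc d)} (monge⁻ i d₀ i< d≤N) (monge⁻ i d i< d<N)
          cases : ∀ j → j < N → Dec (j ≡ d₀) → Dec (j ≡ d) → column (D false) i j ⊑ column (D false) i (suc j)
          cases j _ (yes refl) _ = subst₂ _⊑_ (sym (column-other d₀ (1+n≢n ∘ sym))) (sym column-d) (⊑-suc⊓ {D⁻ i d₀} {D⁻ (suc i) d₀} {D⁻ i (suc d)} left⊑below)
          cases j _ (no _) (yes refl) = subst₂ _⊑_ (sym column-d) (sym (column-other (suc d) 1+n≢n)) (suc⊓-⊑ {D⁻ i d₀} {D⁻ (suc i) d₀} {D⁻ i (suc d)} left⊑below)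
          cases j j< (no j≢d₀) (no j≢d) =
            subst₂ _⊑_ (sym (column-other j j≢d)) (sym (column-other (suc j) (j≢d₀ ∘ suc-injective))) (monge⁻ i j i< j<)

    extend : DistanceTable σ⁻ → DistanceTable σ
    extend (D⁻ , dist⁻ , monge⁻) = D (S x y) , dist (S x y) refl , monge (S x y)
      where open Extend D⁻ dist⁻ monge⁻

  DownAt : (ℕ → Point) → ℕ → Set
  DownAt σ e = σ e ≡ (proj₁ (σ (suc e)) , suc (proj₂ (σ (suc e))))

  -- Both staircases end at (n , 0), so a strict gap closes by a down step of σ.
  find-down-step : ∀ σ → Staircase n m σ → ∀ k e → e + k ≡ N → π e ≺ σ e →
                   Σ ℕ λ e' → e' < N × π e' ≺ σ e' × DownAt σ e'
  find-down-step σ stσ zero e e≡N π≺σ =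
    ⊥-elim (≺-irrefl (subst₂ _≺_ (staircase-end stπ) (staircase-end stσ)
                       (subst (λ k → π k ≺ σ k) (trans (sym (+-identityʳ e)) e≡N) π≺σ)))
  find-down-step σ stσ (suc k) e e+k≡N π≺σ = continue (next stσ e e<N)
    where
      e<N : e < N
      e<N = subst (e <_) e+k≡N (m<m+n e z<s)
      continue : Step (σ e) (σ (suc e)) → Σ ℕ λ e' → e' < N × π e' ≺ σ e' × DownAt σ e'
      continue (inj₂ down-step)  = e , e<N , π≺σ , down-step
      continue (inj₁ right-step) = find-down-step σ stσ k (suc e) (trans (sym (+-suc e k)) e+k≡N)
                                     (≺-next-after-right π≺σ (next stπ e e<N) right-step)

  -- Both staircases start at (0 , m), so going back from a down step we meet a right step.
  find-corner : ∀ σ → Staircase n m σ → ∀ e → e < N → π e ≺ σ e → DownAt σ e → Corner σ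
  find-corner σ stσ zero _ π≺σ _ =
    ⊥-elim (≺-irrefl (subst₂ _≺_ (staircase-start stπ) (staircase-start stσ) π≺σ))
  find-corner σ stσ (suc e₀) e< π≺σ down-step = continue (next stσ e₀ e₀<N)
    where
      e₀<N : e₀ < N
      e₀<N = <-trans (n<1+n e₀) e<
      continue : Step (σ e₀) (σ (suc e₀)) → Corner σ
      continue (inj₂ down-step₀) =
        find-corner σ stσ e₀ e₀<N (≺-prev-before-down π≺σ (next stπ e₀ e₀<N) down-step₀) down-step₀
      continue (inj₁ right-step) = record
        { d₀ = e₀ ; x = proj₁ (σ e₀) ; y = proj₂ (σ (suc (suc e₀))) ; d<N = e<
        ; σ-left  = cong (proj₁ (σ e₀) ,_) (cong proj₂ turn)
        ; σ-outer = trans right-step (cong (suc (proj₁ (σ e₀)) ,_) (cong proj₂ turn))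
        ; σ-below = cong (_, proj₂ (σ (suc (suc e₀)))) (sym (cong proj₁ turn))
        ; π≺outer = π≺σ
        }
        where
          turn : (suc (proj₁ (σ e₀)) , proj₂ (σ e₀)) ≡ (proj₁ (σ (suc (suc e₀))) , suc (proj₂ (σ (suc (suc e₀)))))
          turn = trans (sym right-step) down-step

  area : (ℕ → Point) → ℕ
  area σ = sumBelow (λ e → proj₁ (σ e)) (suc N)

  record SmallerSlice (σ : ℕ → Point) : Set where
    field
      σ⁻       : ℕ → Point
      stσ⁻     : Staircase n m σ⁻
      π⪯σ⁻     : ∀ e → e ≤ N → π e ⪯ σ⁻ e
      area≡suc : area σ ≡ suc (area σ⁻)
      extend   : DistanceTable σ⁻ → DistanceTable σ

  remove-corner : ∀ σ → Staircase n m σ → (∀ e → e ≤ N → π e ⪯ σ e) → Corner σ → SmallerSlice σ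
  remove-corner σ stσ π⪯σ corner = record
    { σ⁻ = σ⁻ ; stσ⁻ = stσ⁻ ; π⪯σ⁻ = π⪯σ⁻ ; extend = extend
    ; area≡suc = sumBelow-suc-at (λ e → proj₁ (σ e)) (λ e → proj₁ (σ⁻ e)) (suc N) d (s≤s d≤N)
                (trans (cong proj₁ σ-outer) (cong (suc ∘ proj₁) (sym σ⁻-d)))
                (λ e e≢d → cong proj₁ (sym (σ⁻-other e e≢d)))
    }
    where
      open Corner corner
      open RemoveCorner σ stσ π⪯σ corner

  strict-gap? : (σ : ℕ → Point) (K : ℕ) → (∀ e → e < K → ¬ (π e ≺ σ e)) ⊎ (Σ ℕ λ e → e < K × π e ≺ σ e)
  strict-gap? σ zero = inj₁ (λ _ ())
  strict-gap? σ (suc K) with strict-gap? σ K | π K ≺? σ K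
  ... | inj₂ (e , e< , π≺σ) | _       = inj₂ (e , m<n⇒m<1+n e< , π≺σ)
  ... | inj₁ _              | yes π≺σ = inj₂ (K , n<1+n K , π≺σ)
  ... | inj₁ none           | no π⊀σ  = inj₁ λ e e<1+K → below-suc e<1+K (e <? K)
    where
      below-suc : ∀ {e} → e < suc K → Dec (e < K) → ¬ (π e ≺ σ e)
      below-suc _ (yes e<K) = none _ e<K
      below-suc e<1+K (no e≮K) with ≤-antisym (≤-pred e<1+K) (≮⇒≥ e≮K)
      ... | refl = π⊀σ

  flat-or-smaller : ∀ σ → Staircase n m σ → (∀ e → e ≤ N → π e ⪯ σ e) → (∀ e → e ≤ N → σ e ≡ π e) ⊎ SmallerSlice σ
  flat-or-smaller σ stσ π⪯σ with strict-gap? σ (suc N)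
  ... | inj₁ none = inj₁ λ e e≤ → equal (π e) (σ e) (π⪯σ e e≤) (none e (s≤s e≤))
    where
      equal : ∀ p q → p ⪯ q → ¬ (p ≺ q) → q ≡ p
      equal p q (inj₁ p≡q) _ = sym p≡q
      equal p q (inj₂ p≺q) p⊀q = ⊥-elim (p⊀q p≺q)
  ... | inj₂ (e , e< , π≺σ) with find-down-step σ stσ (N ∸ e) e (m+[n∸m]≡n (≤-pred e<)) π≺σ
  ...   | e' , e'<N , π≺σ' , down-step = inj₂ (remove-corner σ stσ π⪯σ (find-corner σ stσ e' e'<N π≺σ' down-step))

  distance-table : ∀ σ → Staircase n m σ → (∀ e → e ≤ N → π e ⪯ σ e) → DistanceTable σ
  distance-table σ stσ π⪯σ = go (area σ) σ stσ π⪯σ ≤-refl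
    where
      go : ∀ k σ → Staircase n m σ → (∀ e → e ≤ N → π e ⪯ σ e) → area σ ≤ k → DistanceTable σ
      go zero σ stσ π⪯σ area≤ with flat-or-smaller σ stσ π⪯σ
      ... | inj₁ σ≡π     = flat-table σ stσ σ≡π
      ... | inj₂ smaller = ⊥-elim (1+n≢0 (trans (sym (SmallerSlice.area≡suc smaller)) (n≤0⇒n≡0 area≤)))
      go (suc k) σ stσ π⪯σ area≤ with flat-or-smaller σ stσ π⪯σ
      ... | inj₁ σ≡π     = flat-table σ stσ σ≡π
      ... | inj₂ smaller = extend (go k σ⁻ stσ⁻ π⪯σ⁻ (≤-pred (subst (_≤ suc k) area≡suc area≤)))
        where open SmallerSlice smaller

  module DistanceFacts (π' : ℕ → Point) (stπ' : Staircase n m π') (π⪯π' : ∀ e → e ≤ N → π e ⪯ π' e)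
                  (D : ℕ → ℕ → ℕ) (dist : ∀ a b → a ≤ N → b ≤ N → IsDist n m π π' S (π a) (π' b) (D a b)) where
    open Walks n m S π π'

    π∈Region : ∀ e → e ≤ N → Region (π e)
    π∈Region = staircase∈Region π' π stπ (λ _ _ → inj₁ refl) π⪯π'

    π'∈Region : ∀ e → e ≤ N → Region (π' e)
    π'∈Region = staircase∈Region π' π' stπ' π⪯π' (λ _ _ → inj₁ refl)

    module Alongπ  = Along π' π stπ π∈Region
    module Alongπ' = Along π' π' stπ' π'∈Region

    same-start : π 0 ≡ π' 0
    same-start = trans (staircase-start stπ) (sym (staircase-start stπ'))

    same-end : π N ≡ π' N
    same-end = trans (staircase-end stπ) (sym (staircase-end stπ'))

    walk : ∀ a b → a ≤ N → b ≤ N → Wk (π a) (π' b) (D a b)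
    walk a b a≤ b≤ = proj₁ (dist a b a≤ b≤)

    minimal : ∀ a b → a ≤ N → b ≤ N → ∀ {w} → Wk (π a) (π' b) w → D a b ≤ w
    minimal a b a≤ b≤ wk = proj₂ (dist a b a≤ b≤) _ wk

    D-bounds : ∀ a b → a ≤ N → b ≤ N → b ≤ a + D a b × a ≤ b + D a b
    D-bounds a b a≤ b≤ with diagIdx-bounds (walk a b a≤ b≤)
    ... | bounds rewrite diagIdx-staircase stπ a a≤ | diagIdx-staircase stπ' b b≤ = bounds

    D-parity : ∀ a b → a ≤ N → b ≤ N → 2 ∣ D a b + (a + b)
    D-parity a b a≤ b≤ with diagIdx-parity (walk a b a≤ b≤)
    ... | even rewrite diagIdx-staircase stπ a a≤ | diagIdx-staircase stπ' b b≤ = subst (2 ∣_) (+-assoc (D a b) a b) even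

    first-col : ∀ i → i ≤ N → D i 0 ≡ i
    first-col i i≤ = ≤-antisym (minimal i 0 i≤ z≤n (castᵗ same-start (Alongπ.walk-backward i 0 z≤n i≤)))
                               (proj₂ (D-bounds i 0 i≤ z≤n))

    first-row : ∀ j → j ≤ N → D 0 j ≡ j
    first-row j j≤ = ≤-antisym (minimal 0 j z≤n j≤ (castˢ (sym same-start) (Alongπ'.walk-forward 0 j z≤n j≤)))
                               (proj₁ (D-bounds 0 j z≤n j≤))

    last-row : ∀ j → j ≤ N → D N j ≡ N ∸ j
    last-row j j≤ = ≤-antisym (minimal N j ≤-refl j≤ (castˢ (sym same-end) (Alongπ'.walk-backward N j j≤ ≤-refl)))
                              (≤-trans (∸-monoˡ-≤ j (proj₂ (D-bounds N j ≤-refl j≤))) (≤-reflexive (m+n∸m≡n j _)))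

    last-col : ∀ i → i ≤ N → D i N ≡ N ∸ i
    last-col i i≤ = ≤-antisym (minimal i N i≤ ≤-refl (castᵗ same-end (Alongπ.walk-forward i N i≤ ≤-refl)))
                              (≤-trans (∸-monoˡ-≤ i (proj₁ (D-bounds i N i≤ ≤-refl))) (≤-reflexive (m+n∸m≡n i _)))

    D-suc-row≤ : ∀ i j → i < N → j ≤ N → D (suc i) j ≤ suc (D i j)
    D-suc-row≤ i j i< j≤ =
      minimal (suc i) j i< j≤ (step (π∈Region (suc i) i<) (AGEdge-sym (Step⇒AGEdge (next stπ i i<))) (walk i j (<⇒≤ i<) j≤))

    D-row≤suc : ∀ i j → i < N → j ≤ N → D i j ≤ suc (D (suc i) j)
    D-row≤suc i j i< j≤ =
      minimal i j (<⇒≤ i<) j≤ (step (π∈Region i (<⇒≤ i<)) (Step⇒AGEdge (next stπ i i<)) (walk (suc i) j i< j≤))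

    D-suc-col≤ : ∀ i j → i ≤ N → j < N → D i (suc j) ≤ suc (D i j)
    D-suc-col≤ i j i≤ j< = ≤-trans
      (minimal i (suc j) i≤ j< (walk i j i≤ (<⇒≤ j<) ▷ Step⇒AGEdge (next stπ' j j<) ∶ π'∈Region (suc j) j<))
      (≤-reflexive (+-comm _ 1))

    D-col≤suc : ∀ i j → i ≤ N → j < N → D i j ≤ suc (D i (suc j))
    D-col≤suc i j i≤ j< = ≤-trans
      (minimal i j i≤ (<⇒≤ j<) (walk i (suc j) i≤ j< ▷ AGEdge-sym (Step⇒AGEdge (next stπ' j j<)) ∶ π'∈Region j (<⇒≤ j<)))
      (≤-reflexive (+-comm _ 1))

    isUnitStepMonge : IsMongeℕ N D → IsUnitStepMonge N D
    isUnitStepMonge monge = record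
      { monge      = monge
      ; vertical   = λ i j i< j≤ → one-apart (D (suc i) j) (D i j) (i + j) (D-suc-row≤ i j i< j≤) (D-row≤suc i j i< j≤)
                                     (D-parity (suc i) j i< j≤) (D-parity i j (<⇒≤ i<) j≤)
      ; horizontal = λ i j i≤ j< → one-apart (D i (suc j)) (D i j) (i + j) (D-suc-col≤ i j i≤ j<) (D-col≤suc i j i≤ j<)
                                     (subst (λ k → 2 ∣ D i (suc j) + k) (+-suc i j) (D-parity i (suc j) i≤ j<))
                                     (D-parity i j i≤ (<⇒≤ j<))
      ; first-col  = first-col
      ; first-row  = first-row
      ; last-col   = last-col
      ; last-row   = last-row
      }

  slice-distances : ∀ π' → Staircase n m π' → (∀ e → e ≤ N → π e ⪯ π' e) →
    Σ (ℕ → ℕ → ℕ) λ D → (∀ a b → a ≤ N → b ≤ N → IsDist n m π π' S (π a) (π' b) (D a b)) × IsUnitStepMonge N D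
  slice-distances π' stπ' π⪯π' with distance-table π' stπ' π⪯π'
  ... | D , dist , monge = D , dist , DistanceFacts.isUnitStepMonge π' stπ' π⪯π' D dist monge

lemma3p18 : (n m : ℕ) (S : ℕ → ℕ → Bool) →
    (∀ x y → S x y ≡ true → x < n × y < m) →
    (π π' : ℕ → Point) → IsCutPath n m π → IsCutPath n m π' → CutLeq n m π π' →
    Σ (ℕ → ℕ → ℕ) λ D →
      (∀ a b → a ≤ n + m → b ≤ n + m → IsDist n m π π' S (π a) (π' b) (D a b)) ×
      IsMonge (n + m) (n + m) (Dmat D) ×
      IsUnitMonge (n + m) (n + m) (Mmat D) ×
      IsSimple (n + m) (n + m) (Mmat D)
lemma3p18 n m S _ π π' cutπ cutπ' π⪯π' =
  let D , dist , T = Slice.slice-distances n m S π (cutPath⇒staircase cutπ) π' (cutPath⇒staircase cutπ') π⪯π'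
  in  D , dist , UnitMonge.isMonge T , UnitMonge.isUnitMonge T , UnitMonge.isSimple T
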